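{- Let $G$ be a nontrivial connected graph of order $n$. Then $\gamma_{tR2}(G)=n$ if and only if $G\in\{K_2,K_{1,2}\}$ or every vertex of $G$ is either a leaf or a weak support vertex.
   Context: All graphs are finite and simple. A leaf is a vertex of degree one; a support vertex is a vertex adjacent to a leaf; a support vertex is weak if it is adjacent to exactly one leaf. For $f:V(G)\to\{0,1,2\}$ let $V_i=\{v:f(v)=i\}$; $f$ is a total Roman $\{2\}$-dominating function (TR2DF) if every vertex $v$ with $f(v)=0$ has a neighbor $u$ with $f(u)=2$ or two distinct neighbors $x,y$ with $f(x)=f(y)=1$, and the subgraph induced by $V_1\cup V_2$ has no isolated vertices. $\gamma_{tR2}(G)$ is the minimum weight $\sum_v f(v)$ of a TR2DF of $G$. -}

module Defs where

open import Data.Nat using (ℕ; zero; suc; _+_; _≤_; _≥_)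
open import Data.Nat.Base using (_≡ᵇ_)
open import Data.Fin using (Fin; zero; suc)
open import Data.Bool using (Bool; true; false; if_then_else_; _∧_)
open import Data.List using (List; map; allFin)
open import Data.Nat.ListAction using (sum)
open import Data.Product using (Σ; _×_; ∃; ∃-syntax; _,_)
open import Data.Sum using (_⊎_)
open import Relation.Binary.PropositionalEquality using (_≡_; _≢_)
open import Function.Bundles using (_↔_; Inverse)

record Graph (n : ℕ) : Set where
  field
    adj    : Fin n → Fin n → Bool
    sym    : ∀ u v → adj u v ≡ adj v u
    irrefl : ∀ v → adj v v ≡ false
open Graph public

Σv : ∀ {n} → (Fin n → ℕ) → ℕ
Σv {n} f = sum (map f (allFin n))

ind : Bool → ℕ
ind b = if b then 1 else 0

degree : ∀ {n} → Graph n → Fin n → ℕ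
degree G v = Σv (λ u → ind (adj G v u))

Leaf : ∀ {n} → Graph n → Fin n → Set
Leaf G v = degree G v ≡ 1

isLeafᵇ : ∀ {n} → Graph n → Fin n → Bool
isLeafᵇ G v = degree G v ≡ᵇ 1

leafNeighbours : ∀ {n} → Graph n → Fin n → ℕ
leafNeighbours G v = Σv (λ u → ind (adj G v u ∧ isLeafᵇ G u))

WeakSupport : ∀ {n} → Graph n → Fin n → Set
WeakSupport G v = leafNeighbours G v ≡ 1

data Reach {n} (G : Graph n) : Fin n → Fin n → Set where
  here : ∀ {v} → Reach G v v
  step : ∀ {u w v} → adj G u w ≡ true → Reach G w v → Reach G u v

Connected : ∀ {n} → Graph n → Set
Connected {n} G = (u v : Fin n) → Reach G u v

IsTR2DF : ∀ {n} → Graph n → (Fin n → ℕ) → Set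
IsTR2DF {n} G f =
  (∀ v → f v ≤ 2)
  × (∀ v → f v ≡ 0 →
       (∃[ u ] (adj G v u ≡ true × f u ≡ 2))
       ⊎ (∃[ x ] ∃[ y ] (x ≢ y × adj G v x ≡ true × adj G v y ≡ true
                         × f x ≡ 1 × f y ≡ 1)))
  × (∀ v → f v ≢ 0 → ∃[ u ] (adj G v u ≡ true × f u ≢ 0))

weight : ∀ {n} → (Fin n → ℕ) → ℕ
weight f = Σv f

γtR2≡ : ∀ {n} → Graph n → ℕ → Set
γtR2≡ {n} G k =
  (Σ (Fin n → ℕ) λ f → IsTR2DF G f × weight f ≡ k)
  × (∀ (f : Fin n → ℕ) → IsTR2DF G f → weight f ≥ k)

_≅_ : ∀ {n m} → Graph n → Graph m → Set
_≅_ {n} {m} G H = Σ (Fin n ↔ Fin m) λ φ →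
  ∀ u v → adj G u v ≡ adj H (Inverse.to φ u) (Inverse.to φ v)

K₂ : Graph 2
K₂ = record { adj = a ; sym = s ; irrefl = i }
  where
  a : Fin 2 → Fin 2 → Bool
  a zero (suc zero) = true
  a (suc zero) zero = true
  a _ _ = false
  s : ∀ u v → a u v ≡ a v u
  s zero zero = _≡_.refl
  s zero (suc zero) = _≡_.refl
  s (suc zero) zero = _≡_.refl
  s (suc zero) (suc zero) = _≡_.refl
  i : ∀ v → a v v ≡ false
  i zero = _≡_.refl
  i (suc zero) = _≡_.refl

K₁₂ : Graph 3
K₁₂ = record { adj = a ; sym = s ; irrefl = i }
  where
  a : Fin 3 → Fin 3 → Bool
  a zero (suc _) = true
  a (suc _) zero = true
  a _ _ = false
  s : ∀ u v → a u v ≡ a v u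
  s zero zero = _≡_.refl
  s zero (suc _) = _≡_.refl
  s (suc _) zero = _≡_.refl
  s (suc zero) (suc zero) = _≡_.refl
  s (suc zero) (suc (suc zero)) = _≡_.refl
  s (suc (suc zero)) (suc zero) = _≡_.refl
  s (suc (suc zero)) (suc (suc zero)) = _≡_.refl
  i : ∀ v → a v v ≡ false
  i zero = _≡_.refl
  i (suc zero) = _≡_.refl
  i (suc (suc zero)) = _≡_.refl

-- If every vertex is a leaf or a weak support vertex, sending each vertex to its leaf-or-support
-- partner is an involution of V(G), and every TR2DF puts weight at least 2 on each pair {leaf,
-- support}: a leaf of value 0 is dominated only through its single neighbour, which must then
-- carry 2, and a positive leaf needs a positive neighbour. Summing over the pairs counts every
-- vertex twice, so the weight is at least n; the constant function 1 attains n. For K₂ and K₁,₂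
-- the same pendant estimates, transported along the isomorphism, bound the weight below by 2 and
-- 3. Conversely, let v be neither a leaf nor a weak support vertex. If v has no leaf neighbour,
-- setting f v = 0 and f = 1 elsewhere is a TR2DF of weight n - 1. Otherwise v has two leaf
-- neighbours a and b; if v has a further neighbour, putting 2 on v, 0 on a and b and 1 elsewhere
-- again has weight n - 1, and if not, connectivity leaves no vertex outside {v, a, b}, so G ≅
-- K₁,₂.

module Submission where

open import Defs hiding (sym)
open import Data.Nat using (ℕ; zero; suc; _+_; _*_; _≤_; _<_; _≥_; z≤n; s≤s)
open import Data.Nat.Properties
  using ( _≟_; ≡ᵇ⇒≡; ≡⇒≡ᵇ; +-comm; +-assoc; +-identityʳ; *-comm; *-identityʳ; *-zeroʳ
        ; ≤-refl; ≤-reflexive; ≤-trans; n≤1+n; m≤m+n; m≤n+m; n≢0⇒n>0; <⇒≱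
        ; +-mono-≤; +-monoʳ-≤; +-cancelʳ-≤; *-cancelʳ-≤
        ; +-commutativeSemigroup; +-0-commutativeMonoid; module ≤-Reasoning )
import Data.Nat.ListAction as List
open import Data.Fin using (Fin; zero; suc) renaming (_≟_ to _≟ᶠ_)
open import Data.Fin.Properties
  using (all?; any?; ¬∀⟶∃¬; injective⇒≤) renaming (suc-injective to fin-suc-injective)
open import Data.Bool using (Bool; true; false; _∧_; if_then_else_)
import Data.Bool.Properties as BoolP
open BoolP using (T-≡)
open import Data.List using (tabulate)
open import Data.List.Properties using (map-tabulate)
open import Data.Vec.Functional using (updateAt)
open import Data.Vec.Functional.Properties using (updateAt-updates; updateAt-minimal)
open import Data.Product using (∃; ∃-syntax; _×_; _,_; proj₁; proj₂; map₂)
open import Data.Sum using (_⊎_; inj₁; inj₂; swap) renaming (map to ⊎-map)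
open import Relation.Nullary
  using (¬_; Dec; yes; no; does; contradiction; ¬?; _×-dec_; _⊎-dec_; decidable-stable)
open import Relation.Nullary.Decidable using (dec-true; dec-false)
open import Relation.Binary.PropositionalEquality
open import Function using (_∘_; id; const)
open import Function.Definitions using (Injective)
open import Function.Bundles using (_⇔_; mk⇔; Equivalence; Inverse; mk↔ₛ′)
import Data.Fin.Permutation as Perm
open import Algebra.Properties.CommutativeSemigroup +-commutativeSemigroup using (xy∙z≈zy∙x)
open import Algebra.Properties.CommutativeMonoid.Sum +-0-commutativeMonoid
  using (sum; sum-cong-≗; ∑-distrib-+; sum-permute)

Σv≡sum : ∀ {n} (f : Fin n → ℕ) → Σv f ≡ sum f
Σv≡sum f = trans (cong List.sum (map-tabulate id f)) (sum-tabulate f)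
  where
  sum-tabulate : ∀ {n} (g : Fin n → ℕ) → List.sum (tabulate g) ≡ sum g
  sum-tabulate {zero}  g = refl
  sum-tabulate {suc n} g = cong (g zero +_) (sum-tabulate (g ∘ suc))

Σv-cong : ∀ {n} {f g : Fin n → ℕ} → (∀ i → f i ≡ g i) → Σv f ≡ Σv g
Σv-cong {f = f} {g} f≗g rewrite Σv≡sum f | Σv≡sum g = sum-cong-≗ f≗g

Σv-suc : ∀ {n} (f : Fin (suc n) → ℕ) → Σv f ≡ f zero + Σv (f ∘ suc)
Σv-suc f = trans (Σv≡sum f) (cong (f zero +_) (sym (Σv≡sum (f ∘ suc))))

Σv-const : ∀ n (c : ℕ) → Σv {n} (const c) ≡ n * c
Σv-const zero    c = refl
Σv-const (suc n) c = trans (Σv-suc {n} (const c)) (cong (c +_) (Σv-const n c))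

Σv-mono : ∀ {n} {f g : Fin n → ℕ} → (∀ i → f i ≤ g i) → Σv f ≤ Σv g
Σv-mono {zero}          f≤g = z≤n
Σv-mono {suc n} {f} {g} f≤g rewrite Σv-suc f | Σv-suc g =
  +-mono-≤ (f≤g zero) (Σv-mono (f≤g ∘ suc))

Σv-+ : ∀ {n} (f g : Fin n → ℕ) → Σv (λ i → f i + g i) ≡ Σv f + Σv g
Σv-+ f g rewrite Σv≡sum f | Σv≡sum g = trans (Σv≡sum (λ i → f i + g i)) (∑-distrib-+ f g)

Σv-involution : ∀ {n} (f : Fin n → ℕ) (p : Fin n → Fin n) →
                (∀ i → p (p i) ≡ i) → Σv (f ∘ p) ≡ Σv f
Σv-involution f p p∘p≗id rewrite Σv≡sum f | Σv≡sum (f ∘ p) =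
  sym (sum-permute f (Perm.permutation p p p∘p≗id p∘p≗id))

Σv-point : ∀ {n} (f : Fin n → ℕ) i → f i ≤ Σv f
Σv-point f zero    rewrite Σv-suc f = m≤m+n (f zero) _
Σv-point f (suc i) rewrite Σv-suc f = ≤-trans (Σv-point (f ∘ suc) i) (m≤n+m _ (f zero))

Σv-nonzero : ∀ {n} (f : Fin n → ℕ) → Σv f ≢ 0 → ∃[ i ] f i ≢ 0
Σv-nonzero {zero}  f Σ≢0 = contradiction refl Σ≢0
Σv-nonzero {suc n} f Σ≢0 with f zero ≟ 0
... | no  f0≢0 = zero , f0≢0
... | yes f0≡0 with Σv-nonzero (f ∘ suc) (Σ≢0 ∘ λ Σ≡0 → trans (Σv-suc f) (cong₂ _+_ f0≡0 Σ≡0))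
...   | i , fi≢0 = suc i , fi≢0

Σv-updateAt : ∀ {n} (f : Fin n → ℕ) i x → Σv (updateAt f i (const x)) + f i ≡ Σv f + x
Σv-updateAt f zero x rewrite Σv-suc (updateAt f zero (const x)) | Σv-suc f =
  xy∙z≈zy∙x x (Σv (f ∘ suc)) (f zero)
Σv-updateAt f (suc i) x rewrite Σv-suc (updateAt f (suc i) (const x)) | Σv-suc f = begin
  f zero + Σv g + f (suc i)    ≡⟨ +-assoc (f zero) _ _ ⟩
  f zero + (Σv g + f (suc i))  ≡⟨ cong (f zero +_) (Σv-updateAt (f ∘ suc) i x) ⟩
  f zero + (Σv (f ∘ suc) + x)  ≡⟨ +-assoc (f zero) _ x ⟨
  f zero + Σv (f ∘ suc) + x    ∎
  where
  open ≡-Reasoning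
  g : Fin _ → ℕ
  g = updateAt (f ∘ suc) i (const x)

Σv-one : ∀ {n} → Σv {n} (const 1) ≡ n
Σv-one {n} = trans (Σv-const n 1) (*-identityʳ n)

Σv-decrement : ∀ {n} (f : Fin n → ℕ) i → f i ≡ 1 → Σv (updateAt f i (const 0)) + 1 ≡ Σv f
Σv-decrement f i fi≡1 =
  trans (cong (Σv (updateAt f i (const 0)) +_) (sym fi≡1)) (trans (Σv-updateAt f i 0) (+-identityʳ (Σv f)))

updateAt-preserves : ∀ {n} (P : ℕ → Set) {g : Fin n → ℕ} {i x} →
                     (∀ j → P (g j)) → P x → ∀ j → P (updateAt g i (const x) j)
updateAt-preserves P {g} {i} Pg Px j with j ≟ᶠ i
... | yes refl = subst P (sym (updateAt-updates i g)) Px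
... | no  j≢i  = subst P (sym (updateAt-minimal j i g j≢i)) (Pg j)

Σv-∘-injective : ∀ {k n} (f : Fin n → ℕ) (e : Fin k → Fin n) →
                 Injective _≡_ _≡_ e → Σv (f ∘ e) ≤ Σv f
Σv-∘-injective {zero}  f e e-inj = z≤n
Σv-∘-injective {suc k} f e e-inj = begin
  Σv (f ∘ e)                     ≡⟨ Σv-suc (f ∘ e) ⟩
  f (e zero) + Σv (f ∘ e ∘ suc)  ≡⟨ cong (f (e zero) +_) (Σv-cong (λ j → sym (g-off j))) ⟩
  f (e zero) + Σv (g ∘ e ∘ suc)  ≤⟨ +-monoʳ-≤ (f (e zero)) (Σv-∘-injective g (e ∘ suc) e∘suc-injective) ⟩
  f (e zero) + Σv g              ≡⟨ +-comm (f (e zero)) (Σv g) ⟩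
  Σv g + f (e zero)              ≡⟨ trans (Σv-updateAt f (e zero) 0) (+-identityʳ (Σv f)) ⟩
  Σv f                           ∎
  where
  open ≤-Reasoning
  g : Fin _ → ℕ
  g = updateAt f (e zero) (const 0)
  e∘suc-injective : Injective _≡_ _≡_ (e ∘ suc)
  e∘suc-injective = fin-suc-injective ∘ e-inj
  g-off : ∀ j → g (e (suc j)) ≡ f (e (suc j))
  g-off j = updateAt-minimal (e (suc j)) (e zero) f ((λ ()) ∘ e-inj)

Σv-pair : ∀ {n} (f : Fin n → ℕ) {i j} → i ≢ j → f i + f j ≤ Σv f
Σv-pair f {i} {j} i≢j =
  subst (_≤ Σv f) (cong (f i +_) (+-identityʳ (f j))) (Σv-∘-injective f e e-injective)
  where
  e : Fin 2 → Fin _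
  e zero       = i
  e (suc zero) = j
  e-injective : Injective _≡_ _≡_ e
  e-injective {zero}     {zero}     _  = refl
  e-injective {zero}     {suc zero} eq = contradiction eq i≢j
  e-injective {suc zero} {zero}     eq = contradiction (sym eq) i≢j
  e-injective {suc zero} {suc zero} _  = refl

count : ∀ {n} → (Fin n → Bool) → ℕ
count p = Σv (λ u → ind (p u))

Unique : ∀ {n} → (Fin n → Bool) → Fin n → Set
Unique p s = p s ≡ true × (∀ u → p u ≡ true → u ≡ s)

module _ {n} {p : Fin n → Bool} where

  true⇒count≢0 : ∀ {u} → p u ≡ true → count p ≢ 0
  true⇒count≢0 {u} pu count≡0 =
    contradiction (subst₂ _≤_ (cong ind pu) count≡0 (Σv-point _ u)) λ ()

  count≢0⇒∃ : count p ≢ 0 → ∃[ u ] p u ≡ true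
  count≢0⇒∃ count≢0 with Σv-nonzero _ count≢0
  ... | u , ind≢0 with p u in pu
  ...   | true  = u , pu
  ...   | false = contradiction refl ind≢0

  count-pair : ∀ {u w} → u ≢ w → p u ≡ true → p w ≡ true → 2 ≤ count p
  count-pair u≢w pu pw = subst (_≤ count p) (cong₂ (λ x y → ind x + ind y) pu pw) (Σv-pair _ u≢w)

  count≡1⇔unique : count p ≡ 1 ⇔ ∃ (Unique p)
  count≡1⇔unique = mk⇔ unique-of-count unique⇒count
    where
    unique-of-count : count p ≡ 1 → ∃ (Unique p)
    unique-of-count count≡1 with count≢0⇒∃ (subst (_≢ 0) (sym count≡1) λ ())
    ... | s , ps = s , ps , only-s
      where
      only-s : ∀ u → p u ≡ true → u ≡ s
      only-s u pu with u ≟ᶠ s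
      ... | yes u≡s = u≡s
      ... | no  u≢s = contradiction (subst (2 ≤_) count≡1 (count-pair u≢s pu ps)) λ { (s≤s ()) }
    unique⇒count : ∃ (Unique p) → count p ≡ 1
    unique⇒count (s , ps , only-s) = begin
      count p      ≡⟨ +-identityʳ (count p) ⟨
      count p + 0  ≡⟨ Σv-updateAt h s 0 ⟨
      Σv g + h s   ≡⟨ cong₂ _+_ Σv-g≡0 (cong ind ps) ⟩
      1            ∎
      where
      open ≡-Reasoning
      h : Fin n → ℕ
      h u = ind (p u)
      g : Fin n → ℕ
      g = updateAt h s (const 0)
      h≡0 : ∀ u → u ≢ s → h u ≡ 0
      h≡0 u u≢s with p u in pu
      ... | true  = contradiction (only-s u pu) u≢s
      ... | false = refl
      g≡0 : ∀ u → g u ≡ 0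
      g≡0 u with u ≟ᶠ s
      ... | yes refl = updateAt-updates s h
      ... | no  u≢s  = trans (updateAt-minimal u s h u≢s) (h≡0 u u≢s)
      Σv-g≡0 : Σv g ≡ 0
      Σv-g≡0 = trans (Σv-cong g≡0) (trans (Σv-const n 0) (*-zeroʳ n))

  ¬unique⇒another : ∀ {s} → p s ≡ true → ¬ Unique p s → ∃[ u ] p u ≡ true × u ≢ s
  ¬unique⇒another {s} ps ¬unique with any? (λ u → (p u BoolP.≟ true) ×-dec ¬? (u ≟ᶠ s))
  ... | yes found = found
  ... | no  none  = contradiction (ps , only-s) ¬unique
    where
    only-s : ∀ u → p u ≡ true → u ≡ s
    only-s u pu = decidable-stable (u ≟ᶠ s) λ u≢s → none (u , pu , u≢s)

Pendant : ∀ {n} → Graph n → Fin n → Fin n → Set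
Pendant G l s = Unique (adj G l) s

record Cherry {n} (G : Graph n) (c a b : Fin n) : Set where
  field
    a≢b          : a ≢ b
    a-pendant    : Pendant G a c
    b-pendant    : Pendant G b c
    c-neighbours : ∀ u → adj G c u ≡ true → u ≡ a ⊎ u ≡ b
open Cherry

K₂-pendant : Pendant K₂ zero (suc zero)
K₂-pendant = refl , λ { zero () ; (suc zero) _ → refl }

K₁₂-cherry : Cherry K₁₂ zero (suc zero) (suc (suc zero))
K₁₂-cherry = record
  { a≢b          = λ ()
  ; a-pendant    = refl , λ { zero _ → refl ; (suc _) () }
  ; b-pendant    = refl , λ { zero _ → refl ; (suc _) () }
  ; c-neighbours = λ { zero () ; (suc zero) _ → inj₁ refl ; (suc (suc zero)) _ → inj₂ refl }
  }

Dominated : ∀ {n} → Graph n → (Fin n → ℕ) → Fin n → Set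
Dominated G f v =
  (∃[ u ] (adj G v u ≡ true × f u ≡ 2))
  ⊎ (∃[ x ] ∃[ y ] (x ≢ y × adj G v x ≡ true × adj G v y ≡ true × f x ≡ 1 × f y ≡ 1))

module _ {n} (G : Graph n) where

  infix 4 _~_
  _~_ : Fin n → Fin n → Set
  u ~ v = adj G u v ≡ true

  ~-sym : ∀ {u v} → u ~ v → v ~ u
  ~-sym {u} {v} u~v = trans (Graph.sym G v u) u~v

  ~⇒≢ : ∀ {u v} → u ~ v → u ≢ v
  ~⇒≢ {u} u~u refl = contradiction (trans (sym u~u) (irrefl G u)) λ ()

  leaf⇔pendant : ∀ {l} → Leaf G l ⇔ ∃ (Pendant G l)
  leaf⇔pendant = count≡1⇔unique

  pendant-at : ∀ {l s} → Leaf G l → s ~ l → Pendant G l s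
  pendant-at leaf s~l with Equivalence.to leaf⇔pendant leaf
  ... | t , _ , only-t = ~-sym s~l , λ u l~u → trans (only-t u l~u) (sym (only-t _ (~-sym s~l)))

  isLeafNeighbour : Fin n → Fin n → Bool
  isLeafNeighbour v u = adj G v u ∧ isLeafᵇ G u

  isLeafᵇ⇔Leaf : ∀ {l} → isLeafᵇ G l ≡ true ⇔ Leaf G l
  isLeafᵇ⇔Leaf {l} =
    mk⇔ (≡ᵇ⇒≡ (degree G l) 1 ∘ Equivalence.from T-≡) (Equivalence.to T-≡ ∘ ≡⇒≡ᵇ (degree G l) 1)

  leaf-neighbour⇒pendant : ∀ {v l} → isLeafNeighbour v l ≡ true → Pendant G l v
  leaf-neighbour⇒pendant {v} {l} _ with adj G v l in v~l | isLeafᵇ G l in leaf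
  ... | true | true = pendant-at (Equivalence.to isLeafᵇ⇔Leaf leaf) v~l

  pendant⇒leaf-neighbour : ∀ {v l} → Pendant G l v → isLeafNeighbour v l ≡ true
  pendant⇒leaf-neighbour {v} {l} pendant
    rewrite ~-sym (proj₁ pendant)
          | Equivalence.from isLeafᵇ⇔Leaf (Equivalence.from leaf⇔pendant (v , pendant)) = refl

  leaf-or-weak? : ∀ v → Dec (Leaf G v ⊎ WeakSupport G v)
  leaf-or-weak? v = degree G v ≟ 1 ⊎-dec leafNeighbours G v ≟ 1

  pendant-weight : ∀ {f l s} → IsTR2DF G f → Pendant G l s → 2 ≤ f l + f s
  pendant-weight {f} {l} {s} (_ , dominated , total) (_ , only-s) with f l ≟ 0
  ... | yes fl≡0 with dominated l fl≡0
  ...   | inj₁ (u , l~u , fu≡2) rewrite fl≡0 | only-s u l~u = ≤-reflexive (sym fu≡2)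
  ...   | inj₂ (x , y , x≢y , l~x , l~y , _) =
          contradiction (trans (only-s x l~x) (sym (only-s y l~y))) x≢y
  pendant-weight {f} {l} {s} (_ , dominated , total) (_ , only-s) | no fl≢0 with total l fl≢0
  ... | u , l~u , fu≢0 rewrite only-s u l~u = +-mono-≤ (n≢0⇒n>0 fl≢0) (n≢0⇒n>0 fu≢0)

  module _ (leaf-or-weak : ∀ v → Leaf G v ⊎ WeakSupport G v) where

    Partners : Fin n → Fin n → Set
    Partners v s = Pendant G v s ⊎ Pendant G s v

    partner : ∀ v → ∃ (Partners v)
    partner v with leaf-or-weak v
    ... | inj₁ leaf = map₂ inj₁ (Equivalence.to leaf⇔pendant leaf)
    ... | inj₂ weak with Equivalence.to count≡1⇔unique weak
    ...   | s , v~s∧leaf , _ = s , inj₂ (leaf-neighbour⇒pendant v~s∧leaf)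

    partners⇒~ : ∀ {v s} → Partners v s → v ~ s
    partners⇒~ (inj₁ (v~s , _)) = v~s
    partners⇒~ (inj₂ (s~v , _)) = ~-sym s~v

    partners-unique : ∀ {v s s′} → Partners v s → Partners v s′ → s ≡ s′
    partners-unique (inj₁ (_ , only-s)) p′ = sym (only-s _ (partners⇒~ p′))
    partners-unique p (inj₁ (_ , only-s′)) = only-s′ _ (partners⇒~ p)
    partners-unique {v} (inj₂ s-pendant) (inj₂ s′-pendant) with leaf-or-weak v
    ... | inj₁ leaf with Equivalence.to leaf⇔pendant leaf
    ...   | t , _ , only-t =
            trans (only-t _ (~-sym (proj₁ s-pendant))) (sym (only-t _ (~-sym (proj₁ s′-pendant))))
    partners-unique {v} (inj₂ s-pendant) (inj₂ s′-pendant) | inj₂ weak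
      with Equivalence.to count≡1⇔unique weak
    ... | t , _ , only-t = trans (only-t _ (pendant⇒leaf-neighbour s-pendant))
                                 (sym (only-t _ (pendant⇒leaf-neighbour s′-pendant)))

    mate : Fin n → Fin n
    mate v = proj₁ (partner v)

    mate-involutive : ∀ v → mate (mate v) ≡ v
    mate-involutive v = partners-unique (proj₂ (partner (mate v))) (swap (proj₂ (partner v)))

    weight≥-of-leaf-or-weak : ∀ {f} → IsTR2DF G f → n ≤ weight f
    weight≥-of-leaf-or-weak {f} f-tr = *-cancelʳ-≤ n (weight f) 2 (begin
      n * 2                       ≡⟨ Σv-const n 2 ⟨
      Σv {n} (const 2)            ≤⟨ Σv-mono mate-weight ⟩
      Σv (λ v → f v + f (mate v)) ≡⟨ Σv-+ f (f ∘ mate) ⟩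
      Σv f + Σv (f ∘ mate)        ≡⟨ cong (Σv f +_) (Σv-involution f mate mate-involutive) ⟩
      Σv f + Σv f                 ≡⟨ cong (Σv f +_) (+-identityʳ (Σv f)) ⟨
      2 * Σv f                    ≡⟨ *-comm 2 (Σv f) ⟩
      Σv f * 2                    ∎)
      where
      open ≤-Reasoning
      mate-weight : ∀ v → 2 ≤ f v + f (mate v)
      mate-weight v with proj₂ (partner v)
      ... | inj₁ v-pendant = pendant-weight f-tr v-pendant
      ... | inj₂ mate-pendant = subst (2 ≤_) (+-comm (f (mate v)) (f v)) (pendant-weight f-tr mate-pendant)

  cherry-weight : ∀ {f c a b} → IsTR2DF G f → Cherry G c a b → 3 ≤ f c + (f a + f b)
  cherry-weight {f} {c} {a} {b} f-tr@(f≤2 , _ , total) cherry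
    with f c | f≤2 c | total c | pendant-weight f-tr (a-pendant cherry) | pendant-weight f-tr (b-pendant cherry)
  ... | 0 | _ | _ | fa+0≥2 | fb+0≥2 =
    ≤-trans (n≤1+n 3)
            (+-mono-≤ (subst (2 ≤_) (+-identityʳ (f a)) fa+0≥2)
                      (subst (2 ≤_) (+-identityʳ (f b)) fb+0≥2))
  ... | 1 | _ | _ | fa+1≥2 | fb+1≥2 =
    s≤s (+-mono-≤ (+-cancelʳ-≤ 1 1 (f a) fa+1≥2) (+-cancelʳ-≤ 1 1 (f b) fb+1≥2))
  ... | suc (suc (suc _)) | s≤s (s≤s ()) | _ | _ | _
  ... | 2 | _ | positive-neighbour | _ | _ with positive-neighbour (λ ())
  ...   | u , c~u , fu≢0 with c-neighbours cherry u c~u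
  ...     | inj₁ refl = s≤s (s≤s (≤-trans (n≢0⇒n>0 fu≢0) (m≤m+n (f u) (f b))))
  ...     | inj₂ refl = s≤s (s≤s (≤-trans (n≢0⇒n>0 fu≢0) (m≤n+m (f u) (f a))))

  module ≅-transport {m} {H : Graph m} (G≅H : G ≅ H) where

    to : Fin n → Fin m
    to = Inverse.to (proj₁ G≅H)

    from : Fin m → Fin n
    from = Inverse.from (proj₁ G≅H)

    from-to : ∀ u → from (to u) ≡ u
    from-to u = Perm.inverseˡ (proj₁ G≅H)

    to-from : ∀ i → to (from i) ≡ i
    to-from i = Perm.inverseʳ (proj₁ G≅H)

    from-injective : Injective _≡_ _≡_ from
    from-injective {i} {j} eq = trans (sym (to-from i)) (trans (cong to eq) (to-from j))

    order≤ : n ≤ m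
    order≤ = injective⇒≤ λ {u} {w} eq → trans (sym (from-to u)) (trans (cong from eq) (from-to w))

    adj-from : ∀ i j → adj G (from i) (from j) ≡ adj H i j
    adj-from i j = trans (proj₂ G≅H (from i) (from j)) (cong₂ (adj H) (to-from i) (to-from j))

    ~-to : ∀ {i u} → from i ~ u → adj H i (to u) ≡ true
    ~-to {i} {u} from-i~u = trans (sym (adj-from i (to u))) (trans (cong (adj G (from i)) (from-to u)) from-i~u)

    pendant : ∀ {l s} → Pendant H l s → Pendant G (from l) (from s)
    pendant {l} {s} (l~s , only-s) =
      trans (adj-from l s) l~s ,
      λ u from-l~u → trans (sym (from-to u)) (cong from (only-s (to u) (~-to from-l~u)))

    cherry : ∀ {c a b} → Cherry H c a b → Cherry G (from c) (from a) (from b)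
    cherry K = record
      { a≢b          = a≢b K ∘ from-injective
      ; a-pendant    = pendant (a-pendant K)
      ; b-pendant    = pendant (b-pendant K)
      ; c-neighbours = λ u from-c~u → ⊎-map (via u) (via u) (c-neighbours K (to u) (~-to from-c~u))
      }
      where
      via : ∀ u {i} → to u ≡ i → u ≡ from i
      via u refl = sym (from-to u)

  weight≥-of-≅K₂ : G ≅ K₂ → ∀ {f} → IsTR2DF G f → n ≤ weight f
  weight≥-of-≅K₂ G≅K₂ {f} f-tr = begin
    n                ≤⟨ order≤ ⟩
    2                ≤⟨ pendant-weight f-tr (pendant K₂-pendant) ⟩
    f a + f b        ≡⟨ cong (f a +_) (+-identityʳ (f b)) ⟨
    Σv (f ∘ from)    ≤⟨ Σv-∘-injective f from from-injective ⟩
    weight f         ∎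
    where
    open ≅-transport {H = K₂} G≅K₂
    open ≤-Reasoning
    a b : Fin n
    a = from zero
    b = from (suc zero)

  weight≥-of-≅K₁₂ : G ≅ K₁₂ → ∀ {f} → IsTR2DF G f → n ≤ weight f
  weight≥-of-≅K₁₂ G≅K₁₂ {f} f-tr = begin
    n                    ≤⟨ order≤ ⟩
    3                    ≤⟨ cherry-weight f-tr (cherry K₁₂-cherry) ⟩
    f c + (f a + f b)    ≡⟨ cong (λ x → f c + (f a + x)) (+-identityʳ (f b)) ⟨
    Σv (f ∘ from)        ≤⟨ Σv-∘-injective f from from-injective ⟩
    weight f             ∎
    where
    open ≅-transport {H = K₁₂} G≅K₁₂
    open ≤-Reasoning
    c a b : Fin n
    c = from zero
    a = from (suc zero)
    b = from (suc (suc zero))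

  cherry⇒≅K₁₂ : Connected G → ∀ {c a b} → Cherry G c a b → G ≅ K₁₂
  cherry⇒≅K₁₂ connected {c} {a} {b} K = mk↔ₛ′ to from to-from from-to , adj-to
    where
    a≢c : a ≢ c
    a≢c = ~⇒≢ (proj₁ (a-pendant K))
    b≢c : b ≢ c
    b≢c = ~⇒≢ (proj₁ (b-pendant K))

    Vertex : Fin n → Set
    Vertex u = u ≡ c ⊎ u ≡ a ⊎ u ≡ b

    step-vertex : ∀ {u w} → u ~ w → Vertex u → Vertex w
    step-vertex u~w (inj₁ refl)        = inj₂ (c-neighbours K _ u~w)
    step-vertex u~w (inj₂ (inj₁ refl)) = inj₁ (proj₂ (a-pendant K) _ u~w)
    step-vertex u~w (inj₂ (inj₂ refl)) = inj₁ (proj₂ (b-pendant K) _ u~w)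

    reach-vertex : ∀ {u w} → Reach G u w → Vertex u → Vertex w
    reach-vertex here           = id
    reach-vertex (step u~x x⇝w) = reach-vertex x⇝w ∘ step-vertex u~x

    vertex : ∀ u → Vertex u
    vertex u = reach-vertex (connected c u) (inj₁ refl)

    to : Fin n → Fin 3
    to u = if does (u ≟ᶠ c) then zero else if does (u ≟ᶠ a) then suc zero else suc (suc zero)

    from : Fin 3 → Fin n
    from zero             = c
    from (suc zero)       = a
    from (suc (suc zero)) = b

    to-c : to c ≡ zero
    to-c rewrite dec-true (c ≟ᶠ c) refl = refl

    to-a : to a ≡ suc zero
    to-a rewrite dec-false (a ≟ᶠ c) a≢c | dec-true (a ≟ᶠ a) refl = refl

    to-b : to b ≡ suc (suc zero)
    to-b rewrite dec-false (b ≟ᶠ c) b≢c | dec-false (b ≟ᶠ a) (≢-sym (a≢b K)) = refl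

    to-from : ∀ i → to (from i) ≡ i
    to-from zero             = to-c
    to-from (suc zero)       = to-a
    to-from (suc (suc zero)) = to-b

    from-to : ∀ u → from (to u) ≡ u
    from-to u with vertex u
    ... | inj₁ refl        rewrite to-c = refl
    ... | inj₂ (inj₁ refl) rewrite to-a = refl
    ... | inj₂ (inj₂ refl) rewrite to-b = refl

    a≁b : adj G a b ≡ false
    a≁b = BoolP.¬-not λ a~b → b≢c (proj₂ (a-pendant K) b a~b)

    b≁a : adj G b a ≡ false
    b≁a = BoolP.¬-not λ b~a → a≢c (proj₂ (b-pendant K) a b~a)

    adj-to : ∀ u w → adj G u w ≡ adj K₁₂ (to u) (to w)
    adj-to u w with vertex u | vertex w
    ... | inj₁ refl        | inj₁ refl        rewrite to-c        = irrefl G c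
    ... | inj₁ refl        | inj₂ (inj₁ refl) rewrite to-c | to-a = ~-sym (proj₁ (a-pendant K))
    ... | inj₁ refl        | inj₂ (inj₂ refl) rewrite to-c | to-b = ~-sym (proj₁ (b-pendant K))
    ... | inj₂ (inj₁ refl) | inj₁ refl        rewrite to-a | to-c = proj₁ (a-pendant K)
    ... | inj₂ (inj₁ refl) | inj₂ (inj₁ refl) rewrite to-a        = irrefl G a
    ... | inj₂ (inj₁ refl) | inj₂ (inj₂ refl) rewrite to-a | to-b = a≁b
    ... | inj₂ (inj₂ refl) | inj₁ refl        rewrite to-b | to-c = proj₁ (b-pendant K)
    ... | inj₂ (inj₂ refl) | inj₂ (inj₁ refl) rewrite to-b | to-a = b≁a
    ... | inj₂ (inj₂ refl) | inj₂ (inj₂ refl) rewrite to-b        = irrefl G b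

  module _ (no-isolated : ∀ v → ∃ (v ~_)) where

    const1-isTR2DF : IsTR2DF G (const 1)
    const1-isTR2DF = (λ _ → s≤s z≤n) , (λ _ ()) , λ v _ → map₂ (_, λ ()) (no-isolated v)

    neighbour-other-than : ∀ {w v} → ¬ Pendant G w v → ∃[ u ] w ~ u × u ≢ v
    neighbour-other-than {w} {v} ¬pendant with adj G w v BoolP.≟ true
    ... | yes w~v = ¬unique⇒another w~v ¬pendant
    ... | no ¬w~v with no-isolated w
    ...   | u , w~u = u , w~u , λ { refl → ¬w~v w~u }

    two-neighbours : ∀ {v} → ¬ Leaf G v → ∃[ x ] ∃[ y ] x ≢ y × v ~ x × v ~ y
    two-neighbours {v} ¬leaf with no-isolated v
    ... | x , v~x with neighbour-other-than (¬leaf ∘ Equivalence.from leaf⇔pendant ∘ (x ,_))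
    ...   | y , v~y , y≢x = x , y , ≢-sym y≢x , v~x , v~y

    Light : Set
    Light = ∃[ f ] IsTR2DF G f × weight f < n

    light : ∀ {f} → IsTR2DF G f → weight f + 1 ≡ n → Light
    light {f} f-tr eq = f , f-tr , subst (_≤ n) (+-comm (weight f) 1) (≤-reflexive eq)

    light-of-no-leaf-neighbour : ∀ {v} → ¬ Leaf G v → leafNeighbours G v ≡ 0 → Light
    light-of-no-leaf-neighbour {v} ¬leaf no-leaf-neighbour =
      light (updateAt-preserves (_≤ 2) (λ _ → s≤s z≤n) z≤n , dominated , total)
            (trans (Σv-decrement (const 1) v refl) Σv-one)
      where
      f : Fin n → ℕ
      f = updateAt (const 1) v (const 0)
      f-off : ∀ {u} → u ≢ v → f u ≡ 1
      f-off {u} = updateAt-minimal u v (const 1)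
      dominated : ∀ w → f w ≡ 0 → Dominated G f w
      dominated w fw≡0 with w ≟ᶠ v
      ... | no  w≢v  = contradiction (trans (sym (f-off w≢v)) fw≡0) λ ()
      ... | yes refl with two-neighbours ¬leaf
      ...   | x , y , x≢y , v~x , v~y =
              inj₂ (x , y , x≢y , v~x , v~y , f-off (≢-sym (~⇒≢ v~x)) , f-off (≢-sym (~⇒≢ v~y)))
      total : ∀ w → f w ≢ 0 → ∃[ u ] w ~ u × f u ≢ 0
      total w _ with neighbour-other-than {w} (λ w-pendant →
        true⇒count≢0 {p = isLeafNeighbour v} (pendant⇒leaf-neighbour w-pendant) no-leaf-neighbour)
      ... | u , w~u , u≢v = u , w~u , λ fu≡0 → contradiction (trans (sym (f-off u≢v)) fu≡0) λ ()

    light-of-third-neighbour : ∀ {v a b c} → a ≢ b → Pendant G a v → Pendant G b v →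
                               v ~ c → c ≢ a → c ≢ b → Light
    light-of-third-neighbour {v} {a} {b} {c} a≢b (a~v , only-v) (b~v , only-v′) v~c c≢a c≢b =
      light (f≤2 , dominated , total) weight+1≡n
      where
      f₁ f₂ f : Fin n → ℕ
      f₁ = updateAt (const 1) a (const 0)
      f₂ = updateAt f₁ b (const 0)
      f  = updateAt f₂ v (const 2)
      v≢a : v ≢ a
      v≢a = ≢-sym (~⇒≢ a~v)
      v≢b : v ≢ b
      v≢b = ≢-sym (~⇒≢ b~v)
      f≤2 : ∀ u → f u ≤ 2
      f≤2 = updateAt-preserves (_≤ 2)
              (updateAt-preserves (_≤ 2) (updateAt-preserves (_≤ 2) (λ _ → s≤s z≤n) z≤n) z≤n) ≤-refl
      fv≡2 : f v ≡ 2
      fv≡2 = updateAt-updates v f₂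
      f₂-off : ∀ {u} → u ≢ a → u ≢ b → f₂ u ≡ 1
      f₂-off {u} u≢a u≢b = trans (updateAt-minimal u b f₁ u≢b) (updateAt-minimal u a (const 1) u≢a)
      positive : ∀ {u} → u ≢ a → u ≢ b → f u ≢ 0
      positive {u} u≢a u≢b with u ≟ᶠ v
      ... | yes refl = subst (_≢ 0) (sym fv≡2) λ ()
      ... | no  u≢v  =
        subst (_≢ 0) (sym (trans (updateAt-minimal u v f₂ u≢v) (f₂-off u≢a u≢b))) λ ()
      f₁b≡1 : f₁ b ≡ 1
      f₁b≡1 = updateAt-minimal b a (const 1) (≢-sym a≢b)
      f₂v≡1 : f₂ v ≡ 1
      f₂v≡1 = f₂-off v≢a v≢b
      weight+1≡n : weight f + 1 ≡ n
      weight+1≡n = begin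
        Σv f + 1      ≡⟨ cong (Σv f +_) f₂v≡1 ⟨
        Σv f + f₂ v   ≡⟨ Σv-updateAt f₂ v 2 ⟩
        Σv f₂ + 2     ≡⟨ +-assoc (Σv f₂) 1 1 ⟨
        Σv f₂ + 1 + 1 ≡⟨ cong (_+ 1) (Σv-decrement f₁ b f₁b≡1) ⟩
        Σv f₁ + 1     ≡⟨ Σv-decrement (const 1) a refl ⟩
        Σv {n} (const 1) ≡⟨ Σv-one ⟩
        n             ∎
        where open ≡-Reasoning
      dominated : ∀ w → f w ≡ 0 → Dominated G f w
      dominated w fw≡0 with w ≟ᶠ a | w ≟ᶠ b
      ... | yes refl | _        = inj₁ (v , a~v , fv≡2)
      ... | no  _    | yes refl = inj₁ (v , b~v , fv≡2)
      ... | no  w≢a  | no  w≢b  = contradiction fw≡0 (positive w≢a w≢b)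
      total : ∀ w → f w ≢ 0 → ∃[ u ] w ~ u × f u ≢ 0
      total w fw≢0 with w ≟ᶠ v
      ... | yes refl = c , v~c , positive c≢a c≢b
      ... | no  w≢v with no-isolated w
      ...   | u , w~u = u , w~u , positive u≢a u≢b
        where
        u≢a : u ≢ a
        u≢a refl = w≢v (only-v w (~-sym w~u))
        u≢b : u ≢ b
        u≢b refl = w≢v (only-v′ w (~-sym w~u))

    light-or-≅K₁₂ : Connected G → ∀ {v} → ¬ (Leaf G v ⊎ WeakSupport G v) → Light ⊎ G ≅ K₁₂
    light-or-≅K₁₂ connected {v} bad with leafNeighbours G v ≟ 0
    ... | yes none = inj₁ (light-of-no-leaf-neighbour (bad ∘ inj₁) none)
    ... | no some with count≢0⇒∃ {p = isLeafNeighbour v} some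
    ...   | a , a-leaf
      with ¬unique⇒another a-leaf (bad ∘ inj₂ ∘ Equivalence.from count≡1⇔unique ∘ (a ,_))
    ...     | b , b-leaf , b≢a
      with any? (λ c → (adj G v c BoolP.≟ true) ×-dec ¬? (c ≟ᶠ a) ×-dec ¬? (c ≟ᶠ b))
    ...       | yes (c , v~c , c≢a , c≢b) =
                inj₁ (light-of-third-neighbour (≢-sym b≢a) (leaf-neighbour⇒pendant a-leaf)
                                                (leaf-neighbour⇒pendant b-leaf) v~c c≢a c≢b)
    ...       | no no-third = inj₂ (cherry⇒≅K₁₂ connected cherry)
      where
      cherry : Cherry G v a b
      cherry = record
        { a≢b          = ≢-sym b≢a
        ; a-pendant    = leaf-neighbour⇒pendant a-leaf
        ; b-pendant    = leaf-neighbour⇒pendant b-leaf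
        ; c-neighbours = only-a-b
        }
        where
        only-a-b : ∀ u → v ~ u → u ≡ a ⊎ u ≡ b
        only-a-b u v~u with u ≟ᶠ a | u ≟ᶠ b
        ... | yes u≡a | _       = inj₁ u≡a
        ... | no  _   | yes u≡b = inj₂ u≡b
        ... | no  u≢a | no  u≢b = contradiction (u , v~u , u≢a , u≢b) no-third

reach-first-step : ∀ {n} {G : Graph n} {u w} → Reach G u w → u ≢ w → ∃[ x ] adj G u x ≡ true
reach-first-step here         u≢u = contradiction refl u≢u
reach-first-step (step u~x _) _   = _ , u~x

connected⇒no-isolated : ∀ {n} (G : Graph n) → 2 ≤ n → Connected G →
                        ∀ v → ∃[ u ] adj G v u ≡ true
connected⇒no-isolated G (s≤s (s≤s _)) connected zero    = reach-first-step (connected zero (suc zero)) λ ()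
connected⇒no-isolated G (s≤s (s≤s _)) connected (suc v) = reach-first-step (connected (suc v) zero) λ ()

mainTheorem12 : (n : ℕ) (G : Graph n) → n ≥ 2 → Connected G →
    (γtR2≡ G n ⇔ ((G ≅ K₂) ⊎ (G ≅ K₁₂) ⊎ (∀ (v : Fin n) → Leaf G v ⊎ WeakSupport G v)))
mainTheorem12 n G n≥2 connected = mk⇔ forward backward
  where
  Characterised : Set
  Characterised = (G ≅ K₂) ⊎ (G ≅ K₁₂) ⊎ (∀ v → Leaf G v ⊎ WeakSupport G v)

  no-isolated : ∀ v → ∃[ u ] adj G v u ≡ true
  no-isolated = connected⇒no-isolated G n≥2 connected

  forward : γtR2≡ G n → Characterised
  forward (_ , minimal) with all? (leaf-or-weak? G)
  ... | yes leaf-or-weak = inj₂ (inj₂ leaf-or-weak)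
  ... | no ¬leaf-or-weak with ¬∀⟶∃¬ n _ (leaf-or-weak? G) ¬leaf-or-weak
  ...   | v , bad with light-or-≅K₁₂ G no-isolated connected bad
  ...     | inj₁ (f , f-tr , weight<n) = contradiction (minimal f f-tr) (<⇒≱ weight<n)
  ...     | inj₂ G≅K₁₂                 = inj₂ (inj₁ G≅K₁₂)

  weight≥ : Characterised → ∀ f → IsTR2DF G f → n ≤ weight f
  weight≥ (inj₁ G≅K₂)                  _ = weight≥-of-≅K₂ G G≅K₂
  weight≥ (inj₂ (inj₁ G≅K₁₂))          _ = weight≥-of-≅K₁₂ G G≅K₁₂
  weight≥ (inj₂ (inj₂ leaf-or-weak))   _ = weight≥-of-leaf-or-weak G leaf-or-weak

  backward : Characterised → γtR2≡ G n
  backward shape = (const 1 , const1-isTR2DF G no-isolated , Σv-one) , weight≥ shape
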